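{- Let $\lambda\in\mathrm{Dyck}(2n)$, $a,b\ge0$, $\mu\in L(\lambda;a,b)$ and $T\in\mathrm{TD}(\lambda/\mu)$. Then every tile of $T$ lies between the paths $\lambda+(-i+1,i-1)$ and $\lambda+(-i,i)$ for some integer $i\ge0$.
   Context: A Dyck path of length $2n$ is a lattice path from $(0,0)$ to $(n,n)$ with unit steps $(0,1),(1,0)$ never going below $y=x$; $\mathrm{Dyck}(2n)$ is their set. For an object $X$, $X+(i,j)$ is its translate by $(i,j)$. For $a,b\ge0$ let $O=(0,0)$, $N=(n,n)$, $P=(-a,a)$, $Q=N+(-b,b)$; $L(\lambda;a,b)$ is the set of lattice paths with steps $(0,1),(1,0)$ from $P$ to $Q$ never going below $\lambda$. For $\mu\in L(\lambda;a,b)$, $\lambda/\mu$ is the region bounded by $\lambda$, $\mu$, $OP$ and $NQ$. A Dyck tile is an edge-connected set of unit cells with no $2\times2$ square whose cell centers, joined from southwest to northeast, form a translate of a Dyck path; its length is the number of steps of that path. A truncated Dyck tile is obtained from a Dyck tile of positive length by removing from its southwest cell the triangle southwest of that cell's slope $-1$ diagonal and from its northeast cell the triangle northeast of that cell's slope $-1$ diagonal. A truncated Dyck tiling of $\lambda/\mu$ is a set $T$ of truncated Dyck tiles with disjoint interiors tiling a sub-region of $\lambda/\mu$ such that (i) for each $\eta\in T$, if $\eta+(1,-1)$ intersects $\lambda/\mu$ (in positive area), some $\eta'\in T$ contains $\eta+(1,-1)$; (ii) no two tiles share a border segment of slope $-1$. $\mathrm{TD}(\lambda/\mu)$ is the set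 of these. -}

module Defs where

open import Data.Nat as ℕ using (ℕ; zero; suc)
open import Data.Integer as ℤ using (ℤ; +_; _+_; _-_; -_; _≤_)
open import Data.List using (List; []; _∷_; length; take)
open import Data.List.Membership.Propositional using (_∈_)
open import Data.List.Relation.Unary.AllPairs using (AllPairs)
open import Data.Product using (_×_; _,_; Σ; ∃; ∃-syntax; proj₁; proj₂)
open import Data.Sum using (_⊎_)
open import Relation.Binary.PropositionalEquality using (_≡_; _≢_)
open import Relation.Nullary using (¬_)
import Data.Empty

-- Lattice paths with unit steps (0,1) = up and (1,0) = right.

data Step : Set where
  up right : Step

countU : List Step → ℕ
countU []            = 0
countU (up ∷ w)      = suc (countU w)
countU (right ∷ w)   = countU w

countR : List Step → ℕ
countR []            = 0
countR (up ∷ w)      = countR w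
countR (right ∷ w)   = suc (countR w)

Point : Set
Point = ℤ × ℤ

_⊕_ : Point → Point → Point
(x , y) ⊕ (x′ , y′) = (x + x′ , y + y′)

record Path : Set where
  constructor path
  field
    start : Point
    steps : List Step
open Path public

pointAt : Path → ℕ → Point
pointAt (path s w) k = s ⊕ (+ countR (take k w) , + countU (take k w))

endPoint : Path → Point
endPoint p = pointAt p (length (steps p))

translate : Path → Point → Path
translate (path s w) d = path (s ⊕ d) w

diagU : Point → ℤ
diagU (x , y) = x + y

hgt : Point → ℤ
hgt (x , y) = y - x

NeverBelowDiagonal : Path → Set
NeverBelowDiagonal p =
  ∀ k → k ℕ.≤ length (steps p) → proj₁ (pointAt p k) ≤ proj₂ (pointAt p k)

-- the path μ never goes below the path λ: at every common anti-diagonal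
-- x+y = const, the point of μ is weakly above-left of the point of λ
NeverBelow : Path → Path → Set
NeverBelow p q =
  ∀ k k′ → k ℕ.≤ length (steps p) → k′ ℕ.≤ length (steps q) →
  diagU (pointAt p k) ≡ diagU (pointAt q k′) →
  hgt (pointAt q k′) ≤ hgt (pointAt p k)

origin : Point
origin = (+ 0 , + 0)

IsDyck : ℕ → List Step → Set
IsDyck n w = endPoint (path origin w) ≡ (+ n , + n) × NeverBelowDiagonal (path origin w)

μPath : ℕ → List Step → Path
μPath a w = path (- (+ a) , + a) w

λPath : List Step → Path
λPath w = path origin w

InL : ℕ → ℕ → ℕ → List Step → List Step → Set
InL n a b wλ wμ =
  endPoint (μPath a wμ) ≡ ((+ n) - (+ b) , (+ n) + (+ b)) × NeverBelow (μPath a wμ) (λPath wλ)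

-- Regions are unions of half unit cells ("atoms"): the unit cell with
-- lower-left corner (x,y) is cut along its slope -1 diagonal into a
-- south-west half and a north-east half.  All regions in question
-- (λ/μ, truncated tiles, translates) are unions of atoms, so
-- "contained in", "disjoint interiors" and "intersect in positive area"
-- are expressed at the level of atoms.

data Half : Set where
  sw ne : Half

Atom : Set
Atom = Point × Half

Region : Set₁
Region = Atom → Set

-- the atom occupies the strip  col ≤ x+y ≤ col+1  and, on the middle line
-- x+y = col + 1/2, the heights  mid - 1/2 ≤ y-x ≤ mid + 1/2
atomCol : Atom → ℤ
atomCol ((x , y) , sw) = x + y
atomCol ((x , y) , ne) = (x + y) + + 1

atomMid : Atom → ℤ
atomMid ((x , y) , _) = y - x

Covers : Path → ℤ → Set
Covers p j = diagU (start p) ≤ j × j + + 1 ≤ diagU (start p) + + length (steps p)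

-- height y-x of p on the anti-diagonal x+y = j (meaningful when covered)
heightOn : Path → ℤ → ℤ
heightOn p j = hgt (pointAt p ℤ.∣ j - diagU (start p) ∣)

-- the atom lies in the region between the lower path A and upper path B
-- (closed off by anti-diagonal segments at their common ends)
Between : Path → Path → Region
Between A B α =
  Covers A j × Covers B j ×
  (heightOn A j + heightOn A (j + + 1) + + 1 ≤ m + m) ×
  (m + m + + 1 ≤ heightOn B j + heightOn B (j + + 1))
  where
  j = atomCol α
  m = atomMid α

-- A Dyck tile of length 2h is given by its
-- south-west cell (corner) and the Dyck path (word) formed by its cell
-- centers; this gives exactly the edge-connected, 2×2-free cell sets of
-- the definition.

record TTile : Set where
  constructor ttile
  field
    corner : Point
    half   : ℕ
    word   : List Step
    dyck   : IsDyck half word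
    pos    : 1 ℕ.≤ half
open TTile public

cellAt : TTile → ℕ → Point
cellAt η k = pointAt (path (corner η) (word η)) k

firstCell lastCell : TTile → Point
firstCell η = cellAt η 0
lastCell  η = cellAt η (length (word η))

-- atoms of the truncated tile: all halves of all cells, except the
-- south-west half of the south-west cell and the north-east half of the
-- north-east cell
InTile : TTile → Region
InTile η (c , h) =
  Σ ℕ λ k → k ℕ.≤ length (word η) × c ≡ cellAt η k ×
    ((h ≡ sw × k ≢ 0) ⊎ (h ≡ ne × k ≢ length (word η)))

shiftTile : TTile → Point → TTile
shiftTile (ttile c h w d p) v = ttile (c ⊕ v) h w d p

-- the border segments of slope -1 of a truncated tile are the slope -1
-- diagonals of its south-west and north-east cells; two unit
-- anti-diagonal segments overlap in a segment iff they are the diagonal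
-- of the same cell
IsDiagCell : TTile → Point → Set
IsDiagCell η c = c ≡ firstCell η ⊎ c ≡ lastCell η

ShareDiagSegment : TTile → TTile → Set
ShareDiagSegment η η′ = ∃[ c ] (IsDiagCell η c × IsDiagCell η′ c)

record IsTD (λ/μ : Region) (T : List TTile) : Set where
  field
    inside   : ∀ {η} → η ∈ T → ∀ α → InTile η α → λ/μ α
    disjoint : AllPairs (λ η η′ → ∀ α → InTile η α → InTile η′ α → Data.Empty.⊥) T
    closed   : ∀ {η} → η ∈ T →
               (∃[ α ] (InTile (shiftTile η (+ 1 , - (+ 1))) α × λ/μ α)) →
               ∃[ η′ ] (η′ ∈ T × (∀ α → InTile (shiftTile η (+ 1 , - (+ 1))) α → InTile η′ α))
    noShare  : AllPairs (λ η η′ → ¬ ShareDiagSegment η η′) T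

module Submission where

-- Measure an atom α lying over column j (the strip
-- j ≤ x+y ≤ j+1) by its excess over λ,
--     excess α = 2·(y−x of α) − (h j + h (j+1)),
-- where h is the height y−x of λ on the anti-diagonals.  Since the two
-- heights differ by one, the excess is odd, and the k-th band
-- 4k+1 ≤ excess ≤ 4k+3 is exactly the strip between λ+(−k,k) and
-- λ+(−k−1,k+1).  Translating an atom by (1,−1) keeps its column and
-- lowers its excess by 4.  Atoms of λ/μ have excess ≥ 1, and an atom of
-- λ/μ with excess ≥ 5 stays in λ/μ after the translation.
--
-- Band lemma: every tile η of T lies in one band.  Induct on the excess
-- of an atom α of η.  If excess α ≥ 5, condition (i) puts η+(1,−1)
-- inside a tile η′ of T, which lies in some band k, so η lies in band
-- k+1.  Otherwise no atom of η+(1,−1) is in λ/μ (condition (i) would put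
-- α+(1,−1) in λ/μ), so every atom of η has excess ≤ 4, i.e. ≤ 3 by
-- parity: η lies in band 0.
--
-- Only condition (i) and the fact that λ is a lattice path from the
-- origin are used; the band lemma is proved for every region with the two
-- properties above, and λ/μ is then shown to be such a region.

open import Defs
open import Data.Nat using (ℕ)
open import Data.Integer using (+_; -_; _-_)
open import Data.List using (List)
open import Data.List.Membership.Propositional using (_∈_)
open import Data.Product using (∃-syntax; _,_)

open import Data.Nat using (zero; suc; z≤n; s≤s)
import Data.Nat as ℕ
import Data.Nat.Properties as ℕP
open import Data.Integer using (ℤ; _+_; _*_; _≤_; +≤+; -[1+_]; _≤?_; ∣_∣)
import Data.Integer.Properties as ℤP
open import Data.Integer.Tactic.RingSolver using (solve-∀)
open import Data.List using ([]; _∷_; length; take)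
open import Data.Product using (_×_; proj₂)
open import Data.Sum using (_⊎_; inj₁; inj₂)
open import Data.Empty using (⊥-elim)
open import Relation.Nullary using (¬_; yes; no; contradiction)
open import Relation.Binary.PropositionalEquality
  using (_≡_; _≢_; refl; sym; trans; cong; cong₂; subst; module ≡-Reasoning)

+≤⇒≤- : ∀ a {b c} → a + c ≤ b → c ≤ b - a
+≤⇒≤- a {b} {c} a+c≤b = begin
  c             ≡⟨ add-sub c a ⟩
  (a + c) - a   ≤⟨ ℤP.+-monoˡ-≤ (- a) a+c≤b ⟩
  b - a         ∎
  where
  open ℤP.≤-Reasoning
  add-sub : ∀ c a → c ≡ (a + c) - a
  add-sub = solve-∀

≤-⇒+≤ : ∀ a b {c} → c ≤ b - a → a + c ≤ b
≤-⇒+≤ a b {c} c≤b-a = begin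
  a + c         ≡⟨ ℤP.+-comm a c ⟩
  c + a         ≤⟨ ℤP.+-monoˡ-≤ a c≤b-a ⟩
  (b - a) + a   ≡⟨ sub-add b a ⟩
  b             ∎
  where
  open ℤP.≤-Reasoning
  sub-add : ∀ b a → (b - a) + a ≡ b
  sub-add = solve-∀

-≤⇒≤+ : ∀ a b {c} → b - a ≤ c → b ≤ a + c
-≤⇒≤+ a b {c} b-a≤c = begin
  b             ≡⟨ sub-add b a ⟩
  (b - a) + a   ≤⟨ ℤP.+-monoˡ-≤ a b-a≤c ⟩
  c + a         ≡⟨ ℤP.+-comm c a ⟩
  a + c         ∎
  where
  open ℤP.≤-Reasoning
  sub-add : ∀ b a → b ≡ (b - a) + a
  sub-add = solve-∀

+-cancelʳ-≤ : ∀ {a b} c → a + c ≤ b + c → a ≤ b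
+-cancelʳ-≤ {a} {b} c a+c≤b+c = begin
  a             ≡⟨ add-sub a c ⟩
  (a + c) - c   ≤⟨ ℤP.+-monoˡ-≤ (- c) a+c≤b+c ⟩
  (b + c) - c   ≡⟨ sym (add-sub b c) ⟩
  b             ∎
  where
  open ℤP.≤-Reasoning
  add-sub : ∀ a c → a ≡ (a + c) - c
  add-sub = solve-∀

Odd : ℤ → Set
Odd z = ∃[ t ] z ≡ t + t + + 1

twice≢1 : ∀ v → v + v ≢ + 1
twice≢1 (+ zero)    ()
twice≢1 (+ suc k)   eq = ℕP.m+1+n≢0 k (ℕP.suc-injective (ℤP.+-injective eq))
twice≢1 -[1+ k ]    ()

odd≢twice : ∀ {z} → Odd z → ∀ u → z ≢ u + u
odd≢twice {z} (t , z≡) u z≡u+u = twice≢1 (u - t) (begin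
  (u - t) + (u - t)         ≡⟨ regroup u t ⟩
  (u + u) - (t + t)         ≡⟨ cong (_- (t + t)) (trans (sym z≡u+u) z≡) ⟩
  (t + t + + 1) - (t + t)   ≡⟨ cancel t ⟩
  + 1                       ∎)
  where
  open ≡-Reasoning
  regroup : ∀ u t → (u - t) + (u - t) ≡ (u + u) - (t + t)
  regroup = solve-∀
  cancel : ∀ t → (t + t + + 1) - (t + t) ≡ + 1
  cancel = solve-∀

odd-below-5 : ∀ {z} → Odd z → ¬ (+ 5 ≤ z) → z ≤ + 3
odd-below-5 {z} odd z≱5 =
  ℤP.i<j⇒i≤pred[j] (ℤP.≤∧≢⇒< z≤4 (odd≢twice odd (+ 2)))
  where
  z≤4 : z ≤ + 4
  z≤4 = ℤP.i<j⇒i≤pred[j] (ℤP.≰⇒> z≱5)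

southEast : Point
southEast = (+ 1 , - (+ 1))

translateAtom : Point → Atom → Atom
translateAtom v (c , h) = (c ⊕ v , h)

shiftAtom : Atom → Atom
shiftAtom = translateAtom southEast

⊕-swap : ∀ c d v → (c ⊕ d) ⊕ v ≡ (c ⊕ v) ⊕ d
⊕-swap (x , y) (dx , dy) (vx , vy) = cong₂ _,_ (swap x dx vx) (swap y dy vy)
  where
  swap : ∀ a b c → (a + b) + c ≡ (a + c) + b
  swap = solve-∀

inTile-translate : ∀ η v α → InTile η α → InTile (shiftTile η v) (translateAtom v α)
inTile-translate (ttile c _ _ _ _) v _ (k , k≤ , refl , side) = k , k≤ , ⊕-swap c _ v , side

tile-empty-or-inhabited : ∀ η → (∀ α → ¬ InTile η α) ⊎ ∃[ α ] InTile η α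
tile-empty-or-inhabited (ttile _ _ [] _ _) = inj₁ λ where
  _ (_ , z≤n , _ , inj₁ (_ , k≢0))   → k≢0 refl
  _ (_ , z≤n , _ , inj₂ (_ , k≢len)) → k≢len refl
tile-empty-or-inhabited η@(ttile _ _ (_ ∷ _) _ _) =
  inj₂ ((cellAt η 0 , ne) , 0 , z≤n , refl , inj₂ (refl , λ ()))

col-shift : ∀ α → atomCol (shiftAtom α) ≡ atomCol α
col-shift ((x , y) , sw) = same-sw x y
  where
  same-sw : ∀ x y → (x + + 1) + (y + - (+ 1)) ≡ x + y
  same-sw = solve-∀
col-shift ((x , y) , ne) = same-ne x y
  where
  same-ne : ∀ x y → ((x + + 1) + (y + - (+ 1))) + + 1 ≡ (x + y) + + 1
  same-ne = solve-∀

mid-shift : ∀ α → atomMid (shiftAtom α) ≡ atomMid α - + 2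
mid-shift ((x , y) , _) = lower x y
  where
  lower : ∀ x y → (y + - (+ 1)) - (x + + 1) ≡ (y - x) - + 2
  lower = solve-∀

height : List Step → ℕ → ℤ
height w k = hgt (pointAt (λPath w) k)

δ : Step → ℤ
δ up    = + 1
δ right = - (+ 1)

height-cons : ∀ s w k → height (s ∷ w) (suc k) ≡ δ s + height w k
height-cons up    w k = up-step (+ countU (take k w)) (+ countR (take k w))
  where
  up-step : ∀ u r → (+ 1 + u) - r ≡ + 1 + (u - r)
  up-step = solve-∀
height-cons right w k = right-step (+ countU (take k w)) (+ countR (take k w))
  where
  right-step : ∀ u r → u - (+ 1 + r) ≡ - (+ 1) + (u - r)
  right-step = solve-∀

-- Consecutive heights differ by one, so their sum is odd.
adjacent-odd : ∀ w k → suc k ℕ.≤ length w → Odd (height w k + height w (suc k))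
adjacent-odd (up ∷ _)    zero _ = + 0 , refl
adjacent-odd (right ∷ _) zero _ = - (+ 1) , refl
adjacent-odd (s ∷ w) (suc k) (s≤s k<len) with adjacent-odd w k k<len
... | t , sum≡ = δ s + t , (begin
  height (s ∷ w) (suc k) + height (s ∷ w) (suc (suc k))
    ≡⟨ cong₂ _+_ (height-cons s w k) (height-cons s w (suc k)) ⟩
  (δ s + height w k) + (δ s + height w (suc k))
    ≡⟨ interchange (δ s) _ _ ⟩
  (δ s + δ s) + (height w k + height w (suc k))
    ≡⟨ cong (λ z → (δ s + δ s) + z) sum≡ ⟩
  (δ s + δ s) + (t + t + + 1)
    ≡⟨ regroup (δ s) t ⟩
  (δ s + t) + (δ s + t) + + 1 ∎)
  where
  open ≡-Reasoning
  interchange : ∀ d a b → (d + a) + (d + b) ≡ (d + d) + (a + b)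
  interchange = solve-∀
  regroup : ∀ d t → (d + d) + (t + t + + 1) ≡ (d + t) + (d + t) + + 1
  regroup = solve-∀

colSum : List Step → ℤ → ℤ
colSum w j = heightOn (λPath w) j + heightOn (λPath w) (j + + 1)

heightOn-λ : ∀ w k → heightOn (λPath w) (+ k) ≡ height w k
heightOn-λ w k = cong (height w) (ℕP.+-identityʳ k)

colSum-odd : ∀ w j → Covers (λPath w) j → Odd (colSum w j)
colSum-odd w .(+ k) (+≤+ {n = k} z≤n , +≤+ k+1≤len) =
  subst Odd (sym (cong₂ _+_ (heightOn-λ w k) next))
    (adjacent-odd w k (subst (ℕ._≤ length w) (ℕP.+-comm k 1) k+1≤len))
  where
  next : heightOn (λPath w) (+ k + + 1) ≡ height w (suc k)
  next = trans (heightOn-λ w (k ℕ.+ 1)) (cong (height w) (ℕP.+-comm k 1))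

module _ (w : List Step) (x y : ℤ) (anti : x + y ≡ + 0) where

  start-diag : diagU (origin ⊕ (x , y)) ≡ + 0
  start-diag = trans (cong₂ _+_ (ℤP.+-identityˡ x) (ℤP.+-identityˡ y)) anti

  covers-translate : ∀ {j} → Covers (λPath w) j → Covers (translate (λPath w) (x , y)) j
  covers-translate {j} = subst (λ d → d ≤ j × j + + 1 ≤ d + + length w) (sym start-diag)

  heightOn-translate : ∀ j →
    heightOn (translate (λPath w) (x , y)) j ≡ heightOn (λPath w) j + (y - x)
  heightOn-translate j = begin
    hgt (pointAt (translate (λPath w) (x , y)) ∣ j - diagU (origin ⊕ (x , y)) ∣)
      ≡⟨ cong (λ d → hgt (pointAt (translate (λPath w) (x , y)) ∣ j - d ∣)) start-diag ⟩
    hgt (pointAt (translate (λPath w) (x , y)) ∣ j - + 0 ∣)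
      ≡⟨ raise x y _ _ ⟩
    heightOn (λPath w) j + (y - x) ∎
    where
    open ≡-Reasoning
    raise : ∀ x y u r → ((+ 0 + y) + u) - ((+ 0 + x) + r) ≡ (u - r) + (y - x)
    raise = solve-∀

module Excess (w : List Step) where

  Λ : Path
  Λ = λPath w

  excess : Atom → ℤ
  excess α = (atomMid α + atomMid α) - colSum w (atomCol α)

  Band : ℕ → Region
  Band k α = Covers Λ (atomCol α) × (+ 4 * + k + + 1 ≤ excess α) × (excess α ≤ + 4 * + k + + 3)

  excess-shift : ∀ α → excess α ≡ excess (shiftAtom α) + + 4
  excess-shift α = begin
    (m + m) - colSum w j
      ≡⟨ lower m (colSum w j) ⟩
    ((m - + 2) + (m - + 2)) - colSum w j + + 4
      ≡⟨ cong₂ (λ m′ j′ → (m′ + m′) - colSum w j′ + + 4) (sym (mid-shift α)) (sym (col-shift α)) ⟩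
    excess (shiftAtom α) + + 4 ∎
    where
    open ≡-Reasoning
    m j : ℤ
    m = atomMid α
    j = atomCol α
    lower : ∀ m s → (m + m) - s ≡ ((m - + 2) + (m - + 2)) - s + + 4
    lower = solve-∀

  excess-odd : ∀ α → Covers Λ (atomCol α) → Odd (excess α)
  excess-odd α cov with colSum-odd w (atomCol α) cov
  ... | t , sum≡ = m - t - + 1 , (begin
    (m + m) - colSum w (atomCol α)  ≡⟨ cong (λ s → (m + m) - s) sum≡ ⟩
    (m + m) - (t + t + + 1)         ≡⟨ regroup m t ⟩
    (m - t - + 1) + (m - t - + 1) + + 1 ∎)
    where
    open ≡-Reasoning
    m : ℤ
    m = atomMid α
    regroup : ∀ m t → (m + m) - (t + t + + 1) ≡ (m - t - + 1) + (m - t - + 1) + + 1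
    regroup = solve-∀

  band-step : ∀ k α → Band k (shiftAtom α) → Band (suc k) α
  band-step k α (cov , lo , hi) = subst (Covers Λ) (col-shift α) cov , lo′ , hi′
    where
    open ℤP.≤-Reasoning
    lower-end : ∀ K → + 4 * (+ 1 + K) + + 1 ≡ (+ 4 * K + + 1) + + 4
    lower-end = solve-∀
    upper-end : ∀ K → (+ 4 * K + + 3) + + 4 ≡ + 4 * (+ 1 + K) + + 3
    upper-end = solve-∀
    lo′ : + 4 * + suc k + + 1 ≤ excess α
    lo′ = begin
      + 4 * + suc k + + 1          ≡⟨ lower-end (+ k) ⟩
      (+ 4 * + k + + 1) + + 4      ≤⟨ ℤP.+-monoˡ-≤ (+ 4) lo ⟩
      excess (shiftAtom α) + + 4   ≡⟨ excess-shift α ⟨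
      excess α                     ∎
    hi′ : excess α ≤ + 4 * + suc k + + 3
    hi′ = begin
      excess α                     ≡⟨ excess-shift α ⟩
      excess (shiftAtom α) + + 4   ≤⟨ ℤP.+-monoˡ-≤ (+ 4) hi ⟩
      (+ 4 * + k + + 3) + + 4      ≡⟨ upper-end (+ k) ⟩
      + 4 * + suc k + + 3          ∎

  band⇒strip : ∀ k α → Band k α →
    Between (translate Λ (+ 1 - + suc k , + suc k - + 1))
            (translate Λ (- (+ suc k) , + suc k)) α
  band⇒strip k α (cov , lo , hi) =
    covers-translate w (+ 1 - I) (I - + 1) lower-anti cov ,
    covers-translate w (- I) I (ℤP.+-inverseˡ I) cov ,
    lower-side ,
    upper-side
    where
    open ℤP.≤-Reasoning
    j m I : ℤ
    j = atomCol α
    m = atomMid α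
    I = + suc k
    lower-anti : (+ 1 - I) + (I - + 1) ≡ + 0
    lower-anti = cancel I
      where
      cancel : ∀ I → (+ 1 - I) + (I - + 1) ≡ + 0
      cancel = solve-∀
    lower-sum : ∀ h₁ h₂ K →
      (h₁ + (((+ 1 + K) - + 1) - (+ 1 - (+ 1 + K)))) + (h₂ + (((+ 1 + K) - + 1) - (+ 1 - (+ 1 + K)))) + + 1
        ≡ (h₁ + h₂) + (+ 4 * K + + 1)
    lower-sum = solve-∀
    upper-sum : ∀ h₁ h₂ K →
      (h₁ + h₂) + (+ 4 * K + + 3) + + 1
        ≡ (h₁ + ((+ 1 + K) - (- (+ 1 + K)))) + (h₂ + ((+ 1 + K) - (- (+ 1 + K))))
    upper-sum = solve-∀
    lower-side : heightOn (translate Λ (+ 1 - I , I - + 1)) j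
                 + heightOn (translate Λ (+ 1 - I , I - + 1)) (j + + 1) + + 1 ≤ m + m
    lower-side = begin
      heightOn (translate Λ (+ 1 - I , I - + 1)) j + heightOn (translate Λ (+ 1 - I , I - + 1)) (j + + 1) + + 1
        ≡⟨ cong₂ (λ p q → p + q + + 1) (heightOn-translate w (+ 1 - I) (I - + 1) lower-anti j)
                                       (heightOn-translate w (+ 1 - I) (I - + 1) lower-anti (j + + 1)) ⟩
      (heightOn Λ j + ((I - + 1) - (+ 1 - I))) + (heightOn Λ (j + + 1) + ((I - + 1) - (+ 1 - I))) + + 1
        ≡⟨ lower-sum (heightOn Λ j) (heightOn Λ (j + + 1)) (+ k) ⟩
      colSum w j + (+ 4 * + k + + 1)
        ≤⟨ ≤-⇒+≤ (colSum w j) (m + m) lo ⟩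
      m + m ∎
    upper-side : m + m + + 1 ≤ heightOn (translate Λ (- I , I)) j
                               + heightOn (translate Λ (- I , I)) (j + + 1)
    upper-side = begin
      m + m + + 1
        ≤⟨ ℤP.+-monoˡ-≤ (+ 1) (-≤⇒≤+ (colSum w j) (m + m) hi) ⟩
      colSum w j + (+ 4 * + k + + 3) + + 1
        ≡⟨ upper-sum (heightOn Λ j) (heightOn Λ (j + + 1)) (+ k) ⟩
      (heightOn Λ j + (I - - I)) + (heightOn Λ (j + + 1) + (I - - I))
        ≡⟨ sym (cong₂ _+_ (heightOn-translate w (- I) I (ℤP.+-inverseˡ I) j)
                          (heightOn-translate w (- I) I (ℤP.+-inverseˡ I) (j + + 1))) ⟩
      heightOn (translate Λ (- I , I)) j + heightOn (translate Λ (- I , I)) (j + + 1) ∎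

  module BandLemma
    (R : Region)
    (R-above    : ∀ α → R α → Covers Λ (atomCol α) × + 1 ≤ excess α)
    (R-pushDown : ∀ α → R α → + 5 ≤ excess α → R (shiftAtom α))
    (T : List TTile) (td : IsTD R T) where

    open IsTD td

    InOneBand : TTile → Set
    InOneBand η = ∃[ k ] (∀ α → InTile η α → Band k α)

    lift : ∀ {η α} → η ∈ T → InTile η α → + 5 ≤ excess α →
           ∃[ η′ ] (η′ ∈ T × (∀ β → InTile (shiftTile η southEast) β → InTile η′ β))
    lift {η} {α} η∈ α∈ high =
      closed η∈ (shiftAtom α , inTile-translate η southEast α α∈ , R-pushDown α (inside η∈ α α∈) high)

    shifted-in-R : ∀ α → R (shiftAtom α) → + 5 ≤ excess α
    shifted-in-R α r =
      subst (+ 5 ≤_) (sym (excess-shift α)) (ℤP.+-monoˡ-≤ (+ 4) (proj₂ (R-above (shiftAtom α) r)))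

    low-tile : ∀ {η α} → η ∈ T → InTile η α → ¬ (+ 5 ≤ excess α) → ∀ β → InTile η β → Band 0 β
    low-tile {η} {α} η∈ α∈ lowα β β∈ with R-above β (inside η∈ β β∈) | + 5 ≤? excess β
    ... | cov , pos | no lowβ = cov , pos , odd-below-5 (excess-odd β cov) lowβ
    ... | _ | yes highβ with lift η∈ β∈ highβ
    ...   | _ , η′∈ , sub =
      contradiction (shifted-in-R α (inside η′∈ (shiftAtom α) (sub (shiftAtom α) α′∈))) lowα
      where
      α′∈ : InTile (shiftTile η southEast) (shiftAtom α)
      α′∈ = inTile-translate η southEast α α∈

    -- Induction on an upper bound N for the excess of an atom of the tile.
    tile-band : ∀ N {η α} → η ∈ T → InTile η α → excess α ≤ + N → InOneBand η
    tile-band zero {η} {α} η∈ α∈ bounded = 0 , low-tile η∈ α∈ not-high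
      where
      not-high : ¬ (+ 5 ≤ excess α)
      not-high high with ℤP.≤-trans high bounded
      ... | +≤+ ()
    tile-band (suc N) {η} {α} η∈ α∈ bounded with + 5 ≤? excess α
    ... | no low = 0 , low-tile η∈ α∈ low
    ... | yes high with lift η∈ α∈ high
    ...   | _ , η′∈ , sub with tile-band N η′∈ (sub (shiftAtom α) (inTile-translate η southEast α α∈)) shifted-bound
      where
      shifted-bound : excess (shiftAtom α) ≤ + N
      shifted-bound = +-cancelʳ-≤ (+ 4) (begin
        excess (shiftAtom α) + + 4   ≡⟨ excess-shift α ⟨
        excess α                     ≤⟨ bounded ⟩
        + suc N                      ≤⟨ ℤP.i≤j+i (+ suc N) (+ 3) ⟩
        + 4 + + N                    ≡⟨ ℤP.+-comm (+ 4) (+ N) ⟩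
        + N + + 4                    ∎)
        where open ℤP.≤-Reasoning
    ...     | k , inBand = suc k , λ β β∈ →
      band-step k β (inBand (shiftAtom β) (sub (shiftAtom β) (inTile-translate η southEast β β∈)))

    tile-band-from : ∀ {η α} → η ∈ T → InTile η α → InOneBand η
    tile-band-from {α = α} η∈ α∈ =
      tile-band ∣ excess α ∣ η∈ α∈ (ℤP.≤-reflexive (sym (ℤP.0≤i⇒+∣i∣≡i 0≤excess)))
      where
      0≤excess : + 0 ≤ excess α
      0≤excess = ℤP.≤-trans (+≤+ z≤n) (proj₂ (R-above α (inside η∈ α α∈)))

    tile-in-band : ∀ {η} → η ∈ T → InOneBand η
    tile-in-band {η} η∈ with tile-empty-or-inhabited η
    ... | inj₁ empty    = 0 , λ β β∈ → ⊥-elim (empty β β∈)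
    ... | inj₂ (α , α∈) = tile-band-from η∈ α∈

module _ (w : List Step) (M : Path) where
  open Excess w

  between-above : ∀ α → Between Λ M α → Covers Λ (atomCol α) × + 1 ≤ excess α
  between-above α (cov , _ , lo , _) = cov , +≤⇒≤- (colSum w (atomCol α)) lo

  -- An atom of λ/μ with excess ≥ 5 stays in λ/μ when lowered by (1,−1):
  -- it keeps excess ≥ 1 and only moves away from the upper path.
  between-pushDown : ∀ α → Between Λ M α → + 5 ≤ excess α → Between Λ M (shiftAtom α)
  between-pushDown α (covΛ , covM , _ , hi) high =
    subst (Covers Λ) (sym (col-shift α)) covΛ ,
    subst (Covers M) (sym (col-shift α)) covM ,
    ≤-⇒+≤ (colSum w (atomCol (shiftAtom α))) (atomMid (shiftAtom α) + atomMid (shiftAtom α))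
      (+-cancelʳ-≤ (+ 4) (subst (+ 5 ≤_) (excess-shift α) high)) ,
    ℤP.≤-trans (ℤP.+-monoˡ-≤ (+ 1) (ℤP.+-mono-≤ mid-lower mid-lower))
      (subst (λ j → atomMid α + atomMid α + + 1 ≤ heightOn M j + heightOn M (j + + 1))
             (sym (col-shift α)) hi)
    where
    mid-lower : atomMid (shiftAtom α) ≤ atomMid α
    mid-lower = subst (_≤ atomMid α) (sym (mid-shift α)) (ℤP.i-j≤i (atomMid α) (+ 2))

lemma3p5 : (n a b : ℕ) (wλ wμ : List Step) → IsDyck n wλ → InL n a b wλ wμ →
    (T : List TTile) → IsTD (Between (λPath wλ) (μPath a wμ)) T →
    ∀ {η} → η ∈ T →
    ∃[ i ] (∀ α → InTile η α →
      Between (translate (λPath wλ) (+ 1 - + i , + i - + 1))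
              (translate (λPath wλ) (- (+ i) , + i)) α)
lemma3p5 _ a _ wλ wμ _ _ T td η∈ =
  let k , inBand = tile-in-band η∈
  in  suc k , λ α α∈ → band⇒strip k α (inBand α α∈)
  where
  open Excess wλ
  open BandLemma (Between Λ (μPath a wμ))
                 (between-above wλ (μPath a wμ))
                 (between-pushDown wλ (μPath a wμ))
                 T td
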